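{- For any reduction graph $G$ such that $S(G)$ is a numerical semigroup, one has $\mathrm{Bal}(G) \le 1$.
   Context: $\mathbb{N}$ = nonnegative integers; $\langle a\rangle := \{an : n\in\mathbb{N}\}$. For sets $A,B\subseteq\mathbb{Z}$, $A+B := \{a+b\}$; $C = A\oplus B$ means $C=A+B$ with unique representations. For a (possibly infinite) family of sets containing $0$, $\sum_i A_i$ is the set of all finite sums of elements from distinct members. A reduction graph $G$ consists of a multicollection $V(G)$ of nodes (nonempty subsets of $\mathbb{N}$ containing $0$) and a finite set $E(G)$ of hyperedges; each edge $e$ has input nodes $B_j$ and output nodes $A_i$ and a finite remainder set $\mathrm{Rem}(e)$ with $\sum_i A_i + \sum_j B_j = (\sum_i A_i)\oplus\mathrm{Rem}(e)$, weight $w(e):=|\mathrm{Rem}(e)|$. Viewing edges as arrows from inputs to outputs, $G$ is acyclic; exactly one node (the root) is an input of no edge and equals $\langle r(G)\rangle$ for a positive integer $r(G)$; every other node is an input of exactly one edge. $S(G) := \sum_{X\in V(G)}X$. The balance is $\mathrm{Bal}(G) := r(G)/\prod_{e\in E(G)} w(e)$. A numerical semigroup is a submonoid of $\mathbb{N}$ with finite complement. -}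

module Defs where

open import Data.Nat using (ℕ; _+_; _*_; _<_; _≤_)
open import Data.Fin using (Fin)
open import Data.List using (List; []; _∷_; map; length; allFin)
open import Data.Nat.ListAction using (product)
open import Data.List.Membership.Propositional using (_∈_)
open import Data.List.Relation.Unary.Unique.Propositional using (Unique)
open import Data.Product using (_×_; ∃; ∃₂; _,_)
open import Relation.Binary.PropositionalEquality using (_≡_; _≢_)
open import Relation.Binary.Construct.Closure.Transitive using (TransClosure)
open import Relation.Nullary using (¬_)

SubN : Set₁
SubN = ℕ → Set

_≐_ : SubN → SubN → Set
A ≐ B = ∀ x → (A x → B x) × (B x → A x)

_+ₛ_ : SubN → SubN → SubN
(A +ₛ B) x = ∃₂ λ a b → A a × B b × x ≡ a + b

ZeroSet : SubN
ZeroSet x = x ≡ 0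

-- Sum of a finite family of sets (each containing 0):
-- all finite sums of elements from distinct members = A₁ + ... + Aₖ.
ΣList : List SubN → SubN
ΣList [] = ZeroSet
ΣList (A ∷ As) = A +ₛ ΣList As

IsDirectSum : SubN → SubN → SubN → Set
IsDirectSum C A R =
  (C ≐ (A +ₛ R)) ×
  (∀ {a a′ r r′} → A a → A a′ → R r → R r′ → a + r ≡ a′ + r′ → (a ≡ a′) × (r ≡ r′))

Multiples : ℕ → SubN
Multiples r x = ∃ λ k → x ≡ r * k

Arrow : {n m : ℕ} → (Fin m → List (Fin n)) → (Fin m → List (Fin n)) → Fin n → Fin n → Set
Arrow {n} {m} ins outs u v = ∃ λ (e : Fin m) → (u ∈ ins e) × (v ∈ outs e)

-- A reduction graph: nodes indexed by Fin nNodes (a multicollection), edges by Fin nEdges.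
record ReductionGraph : Set₁ where
  field
    nNodes : ℕ
    nEdges : ℕ
    node : Fin nNodes → SubN
    node-has-0 : ∀ v → node v 0
    inputs : Fin nEdges → List (Fin nNodes)
    outputs : Fin nEdges → List (Fin nNodes)
    inputs-unique : ∀ e → Unique (inputs e)
    outputs-unique : ∀ e → Unique (outputs e)
    rem : Fin nEdges → List ℕ
    rem-unique : ∀ e → Unique (rem e)
    rem-spec : ∀ e →
      IsDirectSum (ΣList (map node (outputs e)) +ₛ ΣList (map node (inputs e)))
                  (ΣList (map node (outputs e)))
                  (λ x → x ∈ rem e)
    acyclic : ∀ v → ¬ TransClosure (Arrow inputs outputs) v v
    root : Fin nNodes
    root-not-input : ∀ e → ¬ (root ∈ inputs e)
    r : ℕ
    r-pos : 0 < r
    root-is-multiples : node root ≐ Multiples r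
    nonroot-input-once : ∀ v → v ≢ root →
      ∃ λ e → (v ∈ inputs e) × (∀ e′ → v ∈ inputs e′ → e′ ≡ e)

  w : Fin nEdges → ℕ
  w e = length (rem e)

  weightProduct : ℕ
  weightProduct = product (map w (allFin nEdges))

  S : SubN
  S = ΣList (map node (allFin nNodes))

record IsNumericalSemigroup (T : SubN) : Set where
  field
    has-0 : T 0
    closed : ∀ {x y} → T x → T y → T (x + y)
    cofinite : ∃ λ (L : List ℕ) → ∀ x → ¬ T x → x ∈ L

-- Bal(G) ≤ 1, i.e. r(G) / ∏ w(e) ≤ 1 (the product is a positive integer), i.e. r(G) ≤ ∏ w(e).
BalanceAtMostOne : ReductionGraph → Set
BalanceAtMostOne G = ReductionGraph.r G ≤ ReductionGraph.weightProduct G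

module Submission where

-- Write an element x of S(G) as a sum of one element from each node.  Processing
-- the edges so that every edge comes after the edges feeding it (possible by
-- acyclicity), the direct sum Σ outputs + Σ inputs = Σ outputs ⊕ Rem(e) moves the
-- mass sitting on the inputs and outputs of e onto its outputs, up to a remainder
-- in Rem(e).  In the end only the root carries mass, so x ∈ ⟨r⟩ + Σₑ Rem(e).
-- A cofinite S(G) meets every residue class mod r, so the at most ∏ₑ w(e) sums of
-- remainders already represent all r classes.

open import Defs

open import Data.Nat.Properties
open import Algebra.Properties.CommutativeMonoid.Sum +-0-commutativeMonoid
  using (sum-remove; sum-cong-≗; sum-replicate-zero) renaming (sum to ∑)
open import Algebra.Properties.CommutativeSemigroup +-commutativeSemigroup
  using (xy∙z≈zy∙x; xy∙z≈xz∙y; xy∙z≈x∙zy)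
open import Data.Nat
  using (ℕ; zero; suc; s≤s; _+_; _*_; _≤_; _<_; _≤′_; ≤′-refl; ≤′-step; NonZero; >-nonZero)
open import Data.Nat.DivMod using (_%_; [m+kn]%n≡m%n; m<n⇒m%n≡m)
open import Data.Nat.ListAction using (sum; product)
open import Data.Fin using (Fin; zero; suc; punchIn; toℕ)
open import Data.Fin.Properties
  using (punchInᵢ≢i; pigeonhole; injective⇒≤; toℕ<n; toℕ-injective) renaming (_≟_ to _≟ᶠ_)
open import Data.List
  using (List; []; _∷_; _++_; map; length; filter; allFin; tabulate; cartesianProductWith)
open import Data.List.Properties
  using (map-tabulate; map-cong-local; length-++; length-map; filter-notAll)
open import Data.List.Relation.Unary.Any using (Any; here; there; any?; index)
import Data.List.Relation.Unary.All as All
open import Data.List.Relation.Unary.AllPairs using (_∷_)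
open import Data.List.Relation.Unary.Unique.Propositional using (Unique)
open import Data.List.Relation.Unary.Unique.Propositional.Properties
  using (allFin⁺; Unique[x∷xs]⇒x∉xs)
open import Data.List.Membership.Propositional using (_∈_; _∉_; find; lose)
open import Data.List.Membership.Propositional.Properties
  using (∈-cartesianProductWith⁺; ∈-allFin; ∈-filter⁺; ∈-filter⁻; ∈-map⁺)
open import Data.List.Membership.Setoid.Properties using (index-injective)
open import Data.Product using (∃; ∃₂; _×_; _,_; proj₁; proj₂)
open import Data.Vec.Functional using (removeAt)
open import Function using (_∘_)
open import Relation.Binary.Core using (Rel)
open import Relation.Binary.Definitions using (Decidable)
open import Relation.Binary.Construct.Closure.Transitive using (TransClosure; [_]; _∷_)
open import Relation.Binary.PropositionalEquality
  using (_≡_; _≢_; refl; sym; trans; cong; cong₂; subst; setoid; module ≡-Reasoning)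
open import Relation.Nullary using (¬_; Dec; yes; no; ¬?; contradiction; ¬¬-map)
open import Relation.Nullary.Decidable using (decidable-stable)

∑-exchange : ∀ {n} {f g : Fin n → ℕ} (y : Fin n) →
             (∀ i → i ≢ y → f i ≡ g i) → ∑ f + g y ≡ ∑ g + f y
∑-exchange {suc n} {f} {g} y agree = begin
  ∑ f + g y                     ≡⟨ cong (_+ g y) (sum-remove f) ⟩
  f y + ∑ (removeAt f y) + g y  ≡⟨ cong (λ s → f y + s + g y) (sum-cong-≗ agree′) ⟩
  f y + ∑ (removeAt g y) + g y  ≡⟨ xy∙z≈zy∙x (f y) _ (g y) ⟩
  g y + ∑ (removeAt g y) + f y  ≡⟨ cong (_+ f y) (sum-remove g) ⟨
  ∑ g + f y                     ∎
  where
  open ≡-Reasoning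
  agree′ : ∀ j → f (punchIn y j) ≡ g (punchIn y j)
  agree′ j = agree (punchIn y j) (punchInᵢ≢i y j)

∑-δ : ∀ {n} {f : Fin n → ℕ} (y : Fin n) → (∀ i → i ≢ y → f i ≡ 0) → ∑ f ≡ f y
∑-δ {n} {f} y vanish = begin
  ∑ f                    ≡⟨ +-identityʳ (∑ f) ⟨
  ∑ f + 0                ≡⟨ ∑-exchange y vanish ⟩
  ∑ {n} (λ _ → 0) + f y  ≡⟨ cong (_+ f y) (sum-replicate-zero n) ⟩
  f y                    ∎
  where open ≡-Reasoning

∑≡sum-allFin : ∀ {n} (f : Fin n → ℕ) → ∑ f ≡ sum (map f (allFin n))
∑≡sum-allFin f = trans (∑≡sum-tabulate f) (cong sum (sym (map-tabulate (λ i → i) f)))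
  where
  ∑≡sum-tabulate : ∀ {n} (f : Fin n → ℕ) → ∑ f ≡ sum (tabulate f)
  ∑≡sum-tabulate {zero}  f = refl
  ∑≡sum-tabulate {suc n} f = cong (f zero +_) (∑≡sum-tabulate (f ∘ suc))

module _ {n : ℕ} {A : Set} where
  open import Data.List.Membership.DecPropositional (_≟ᶠ_ {n}) using (_∈?_)

  assign : List (Fin n) → (Fin n → A) → (Fin n → A) → Fin n → A
  assign ys g f v with v ∈? ys
  ... | yes _ = g v
  ... | no  _ = f v

  assign-∈ : ∀ ys g f {v} → v ∈ ys → assign ys g f v ≡ g v
  assign-∈ ys g f {v} v∈ys with v ∈? ys
  ... | yes _    = refl
  ... | no  v∉ys = contradiction v∈ys v∉ys

  assign-∉ : ∀ ys g f {v} → v ∉ ys → assign ys g f v ≡ f v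
  assign-∉ ys g f {v} v∉ys with v ∈? ys
  ... | yes v∈ys = contradiction v∈ys v∉ys
  ... | no  _    = refl

  assign-preserves : ∀ {P : Fin n → A → Set} ys g f →
                     (∀ {v} → v ∈ ys → P v (g v)) → (∀ v → P v (f v)) →
                     ∀ v → P v (assign ys g f v)
  assign-preserves ys g f Pg Pf v with v ∈? ys
  ... | yes v∈ys = Pg v∈ys
  ... | no  _    = Pf v

∑-exchange-list : ∀ {n} {f h : Fin n → ℕ} {ys} → Unique ys → (∀ i → i ∉ ys → f i ≡ h i) →
                  ∑ f + sum (map h ys) ≡ ∑ h + sum (map f ys)
∑-exchange-list {ys = []} _ agree = cong (_+ 0) (sum-cong-≗ (λ i → agree i λ ()))
∑-exchange-list {f = f} {h} {y ∷ ys} u@(_ ∷ u′) agree = begin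
  ∑ f + (h y + H)  ≡⟨ +-assoc (∑ f) (h y) H ⟨
  ∑ f + h y + H    ≡⟨ cong (λ s → ∑ f + s + H) (assign-∈ (y ∷ []) h f (here refl)) ⟨
  ∑ f + k y + H    ≡⟨ cong (_+ H) (∑-exchange y f≈k) ⟩
  ∑ k + f y + H    ≡⟨ xy∙z≈xz∙y (∑ k) (f y) H ⟩
  ∑ k + H + f y    ≡⟨ cong (_+ f y) (∑-exchange-list u′ k≈h) ⟩
  ∑ h + K + f y    ≡⟨ cong (λ s → ∑ h + sum s + f y) k≈f-on-ys ⟩
  ∑ h + F + f y    ≡⟨ xy∙z≈x∙zy (∑ h) F (f y) ⟩
  ∑ h + (f y + F)  ∎
  where
  open ≡-Reasoning
  k = assign (y ∷ []) h f
  H = sum (map h ys)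
  K = sum (map k ys)
  F = sum (map f ys)
  f≈k : ∀ i → i ≢ y → f i ≡ k i
  f≈k i i≢y = sym (assign-∉ (y ∷ []) h f λ { (here i≡y) → i≢y i≡y })
  k≈h : ∀ i → i ∉ ys → k i ≡ h i
  k≈h i i∉ys = by-cases (i ≟ᶠ y)
    where
    by-cases : Dec (i ≡ y) → k i ≡ h i
    by-cases (yes refl) = assign-∈ (y ∷ []) h f (here refl)
    by-cases (no  i≢y)  = trans (sym (f≈k i i≢y))
                                (agree i λ { (here i≡y) → i≢y i≡y ; (there i∈ys) → i∉ys i∈ys })
  k≈f-on-ys : map k ys ≡ map f ys
  k≈f-on-ys = map-cong-local (All.tabulate λ v∈ys →
                sym (f≈k _ λ { refl → Unique[x∷xs]⇒x∉xs u v∈ys }))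

∑-assign : ∀ {n} {ys : List (Fin n)} g f → Unique ys →
           ∑ f + sum (map g ys) ≡ ∑ (assign ys g f) + sum (map f ys)
∑-assign {ys = ys} g f u = begin
  ∑ f + sum (map g ys)                ≡⟨ cong (λ s → ∑ f + sum s) assign≡g-on-ys ⟨
  ∑ f + sum (map (assign ys g f) ys)  ≡⟨ ∑-exchange-list u (λ _ v∉ys → sym (assign-∉ ys g f v∉ys)) ⟩
  ∑ (assign ys g f) + sum (map f ys)  ∎
  where
  open ≡-Reasoning
  assign≡g-on-ys : map (assign ys g f) ys ≡ map g ys
  assign≡g-on-ys = map-cong-local (All.tabulate (assign-∈ ys g f))

module _ {n : ℕ} (X : Fin n → SubN) where

  sum-map∈ΣList : ∀ ys {f} → (∀ {v} → v ∈ ys → X v (f v)) → ΣList (map X ys) (sum (map f ys))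
  sum-map∈ΣList []           _   = refl
  sum-map∈ΣList (y ∷ ys) {f} sel =
    f y , sum (map f ys) , sel (here refl) , sum-map∈ΣList ys (sel ∘ there) , refl

  ∈ΣList⇒sum-map : ∀ {ys x} → Unique ys → ΣList (map X ys) x →
                   ∃ λ f → (∀ {v} → v ∈ ys → X v (f v)) × sum (map f ys) ≡ x
  ∈ΣList⇒sum-map {[]}     _          refl                      = (λ _ → 0) , (λ ()) , refl
  ∈ΣList⇒sum-map {y ∷ ys} u@(_ ∷ u′) (a , b , Xa , b∈ΣList , refl) with ∈ΣList⇒sum-map u′ b∈ΣList
  ... | f , f∈X , sum≡b =
    g , g∈X , cong₂ _+_ g-at-y (trans (cong sum (map-cong-local (All.tabulate g≈f))) sum≡b)
    where
    g = assign (y ∷ []) (λ _ → a) f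
    g-at-y : g y ≡ a
    g-at-y = assign-∈ (y ∷ []) _ f (here refl)
    g≈f : ∀ {v} → v ∈ ys → g v ≡ f v
    g≈f v∈ys = assign-∉ (y ∷ []) _ f λ { (here refl) → Unique[x∷xs]⇒x∉xs u v∈ys }
    g∈X : ∀ {v} → v ∈ y ∷ ys → X v (g v)
    g∈X (here refl)  = subst (X y) (sym g-at-y) Xa
    g∈X (there v∈ys) = subst (X _) (sym (g≈f v∈ys)) (f∈X v∈ys)

module _ {m ℓ} {_≺_ : Rel (Fin m) ℓ} (_≺?_ : Decidable _≺_)
         (acyclic : ∀ e → ¬ TransClosure _≺_ e e) where

  -- Otherwise following predecessors inside U visits m + 1 elements of Fin m,
  -- and the pigeonhole principle closes a cycle.
  ∃-minimal : ∀ {U : List (Fin m)} {e₀} → e₀ ∈ U → ∃ λ e → e ∈ U × ¬ Any (_≺ e) U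
  ∃-minimal {U} {e₀} e₀∈U with any? (λ e → ¬? (any? (_≺? e) U)) U
  ... | yes found = find found
  ... | no  none  = contradiction (subst (TransClosure _≺_ _) wᵢ≡wⱼ (walk⁺ (≤⇒≤′ i<j))) (acyclic _)
    where
    predecessor : ∀ {e} → e ∈ U → ∃ λ e′ → e′ ∈ U × e′ ≺ e
    predecessor {e} e∈U with any? (_≺? e) U
    ... | yes p  = find p
    ... | no  ¬p = contradiction (lose e∈U ¬p) none

    walk : ℕ → ∃ (_∈ U)
    walk zero    = e₀ , e₀∈U
    walk (suc i) with predecessor (proj₂ (walk i))
    ... | e′ , e′∈U , _ = e′ , e′∈U

    walk-≺ : ∀ i → proj₁ (walk (suc i)) ≺ proj₁ (walk i)
    walk-≺ i with predecessor (proj₂ (walk i))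
    ... | _ , _ , e′≺e = e′≺e

    walk⁺ : ∀ {i j} → suc i ≤′ j → TransClosure _≺_ (proj₁ (walk j)) (proj₁ (walk i))
    walk⁺ {i} ≤′-refl           = [ walk-≺ i ]
    walk⁺ (≤′-step {j} i<j) = walk-≺ j ∷ walk⁺ i<j

    repeat = pigeonhole (n<1+n m) (λ i → proj₁ (walk (toℕ i)))
    i<j    = proj₁ (proj₂ (proj₂ repeat))
    wᵢ≡wⱼ  = proj₂ (proj₂ (proj₂ repeat))

module _ {m : ℕ} where

  _without_ : List (Fin m) → Fin m → List (Fin m)
  U without e = filter (λ e′ → ¬? (e′ ≟ᶠ e)) U

  ∈-without⁺ : ∀ {U e e′} → e′ ∈ U → e′ ≢ e → e′ ∈ U without e
  ∈-without⁺ = ∈-filter⁺ _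

  ∈-without⁻ : ∀ {U e e′} → e′ ∈ U without e → e′ ∈ U × e′ ≢ e
  ∈-without⁻ = ∈-filter⁻ _

  length-without : ∀ {U e} → e ∈ U → length (U without e) < length U
  length-without {U} {e} e∈U = filter-notAll (λ e′ → ¬? (e′ ≟ᶠ e)) U (lose e∈U λ e≢e → e≢e refl)

length-cartesianProductWith : ∀ {A B C : Set} (f : A → B → C) xs ys →
                              length (cartesianProductWith f xs ys) ≡ length xs * length ys
length-cartesianProductWith f []       ys = refl
length-cartesianProductWith f (x ∷ xs) ys = begin
  length (map (f x) ys ++ cartesianProductWith f xs ys)          ≡⟨ length-++ (map (f x) ys) ⟩
  length (map (f x) ys) + length (cartesianProductWith f xs ys)  ≡⟨ cong₂ _+_ (length-map (f x) ys)
                                                                     (length-cartesianProductWith f xs ys) ⟩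
  length ys + length xs * length ys                               ∎
  where open ≡-Reasoning

choiceSums : ∀ {n} → (Fin n → List ℕ) → List ℕ
choiceSums {zero}  _ = 0 ∷ []
choiceSums {suc n} ℓ = cartesianProductWith _+_ (ℓ zero) (choiceSums (ℓ ∘ suc))

∑∈choiceSums : ∀ {n} {ℓ : Fin n → List ℕ} {f} → (∀ i → f i ∈ ℓ i) → ∑ f ∈ choiceSums ℓ
∑∈choiceSums {zero}  _   = here refl
∑∈choiceSums {suc n} f∈ℓ = ∈-cartesianProductWith⁺ _+_ (f∈ℓ zero) (∑∈choiceSums (f∈ℓ ∘ suc))

length-choiceSums : ∀ {n} (ℓ : Fin n → List ℕ) →
                    length (choiceSums ℓ) ≡ product (map (length ∘ ℓ) (allFin n))
length-choiceSums ℓ =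
  trans (length≡product-tabulate ℓ) (cong product (sym (map-tabulate (λ i → i) (length ∘ ℓ))))
  where
  length≡product-tabulate : ∀ {n} (ℓ : Fin n → List ℕ) →
                            length (choiceSums ℓ) ≡ product (tabulate (length ∘ ℓ))
  length≡product-tabulate {zero}  ℓ = refl
  length≡product-tabulate {suc n} ℓ =
    trans (length-cartesianProductWith _+_ (ℓ zero) _)
          (cong (length (ℓ zero) *_) (length≡product-tabulate (ℓ ∘ suc)))

upTo⊆⇒≤length : ∀ {r} (xs : List ℕ) → (∀ {c} → c < r → c ∈ xs) → r ≤ length xs
upTo⊆⇒≤length {r} xs covers = injective⇒≤ {f = position} position-injective
  where
  position : Fin r → Fin (length xs)
  position c = index (covers (toℕ<n c))
  position-injective : ∀ {c c′} → position c ≡ position c′ → c ≡ c′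
  position-injective eq = toℕ-injective (index-injective (setoid ℕ) (covers _) (covers _) eq)

∈⇒≤sum : ∀ {x xs} → x ∈ xs → x ≤ sum xs
∈⇒≤sum {xs = x ∷ xs} (here refl)  = m≤m+n x (sum xs)
∈⇒≤sum {xs = y ∷ xs} (there x∈xs) = ≤-trans (∈⇒≤sum x∈xs) (m≤n+m (sum xs) y)

-- Cofiniteness only yields ¬ ¬ T x for x outside the exceptional list.
cofinite⇒meets-residue : ∀ {T : SubN} → (∃ λ L → ∀ x → ¬ T x → x ∈ L) →
                         ∀ r .{{_ : NonZero r}} c → ¬ ¬ (∃ λ x → T x × x % r ≡ c % r)
cofinite⇒meets-residue {T} (L , outside⇒∈L) r c none =
  <⇒≱ sum<x (∈⇒≤sum (outside⇒∈L x λ Tx → none (x , Tx , [m+kn]%n≡m%n c k r)))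
  where
  k = suc (sum L)
  x = c + k * r
  sum<x : sum L < x
  sum<x = ≤-trans (m≤m*n k r) (m≤n+m (k * r) c)

module _ (G : ReductionGraph) where
  open ReductionGraph G
  open import Data.List.Membership.DecPropositional (_≟ᶠ_ {nNodes}) using (_∈?_)

  _feeds_ : Fin nEdges → Fin nEdges → Set
  e feeds e′ = ∃ λ v → v ∈ outputs e × v ∈ inputs e′

  _feeds?_ : Decidable _feeds_
  e feeds? e′ with any? (_∈? inputs e′) (outputs e)
  ... | yes p  = yes (find p)
  ... | no  ¬p = no λ (v , v∈out , v∈in) → ¬p (lose v∈out v∈in)

  feeds⁺⇒Arrow⁺ : ∀ {e e′ u v} → TransClosure _feeds_ e e′ → u ∈ inputs e → v ∈ outputs e′ →
                  TransClosure (Arrow inputs outputs) u v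
  feeds⁺⇒Arrow⁺ {e} [ w , w∈out , w∈in ]           u∈in v∈out =
    (e , u∈in , w∈out) ∷ [ _ , w∈in , v∈out ]
  feeds⁺⇒Arrow⁺ {e} ((w , w∈out , w∈in) ∷ chain) u∈in v∈out =
    (e , u∈in , w∈out) ∷ feeds⁺⇒Arrow⁺ chain w∈in v∈out

  feeds-acyclic : ∀ e → ¬ TransClosure _feeds_ e e
  feeds-acyclic e [ v , v∈out , v∈in ]           = acyclic v [ e , v∈in , v∈out ]
  feeds-acyclic e ((v , v∈out , v∈in) ∷ chain) = acyclic v (feeds⁺⇒Arrow⁺ chain v∈in v∈out)

  outputs∉inputs : ∀ {e v} → v ∈ outputs e → v ∉ inputs e
  outputs∉inputs {e} {v} v∈out v∈in = feeds-acyclic e [ v , v∈out , v∈in ]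

  record EdgeReduction (e : Fin nEdges) (val : Fin nNodes → ℕ) : Set where
    field
      val′          : Fin nNodes → ℕ
      remainder     : ℕ
      val′∈node     : ∀ v → node v (val′ v)
      remainder∈rem : remainder ∈ rem e
      inputs-zero   : ∀ {v} → v ∈ inputs e → val′ v ≡ 0
      untouched     : ∀ {v} → v ∉ outputs e → v ∉ inputs e → val′ v ≡ val v
      mass          : ∑ val ≡ ∑ val′ + remainder

  reduce-along : ∀ e {val} → (∀ v → node v (val v)) → EdgeReduction e val
  reduce-along e {val} val∈node
    with proj₁ (proj₁ (rem-spec e) _) (_ , _ , sum-map∈ΣList node (outputs e) (λ _ → val∈node _)
                                               , sum-map∈ΣList node (inputs e) (λ _ → val∈node _) , refl)
  ... | a , ρ₀ , a∈ΣOut , ρ₀∈rem , split with ∈ΣList⇒sum-map node (outputs-unique e) a∈ΣOut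
  ... | g , g∈node , sum-g≡a = record
    { val′          = val₂
    ; remainder     = ρ₀
    ; val′∈node     = assign-preserves {P = node} Out g val₁ g∈node
                        (assign-preserves {P = node} In _ val (λ _ → node-has-0 _) val∈node)
    ; remainder∈rem = ρ₀∈rem
    ; inputs-zero   = λ v∈in → trans (assign-∉ Out g val₁ (λ v∈out → outputs∉inputs v∈out v∈in))
                                     (assign-∈ In _ val v∈in)
    ; untouched     = λ v∉out v∉in → trans (assign-∉ Out g val₁ v∉out) (assign-∉ In _ val v∉in)
    ; mass          = +-cancelʳ-≡ a _ _ mass+a
    }
    where
    Out  = outputs e
    In   = inputs e
    sOut = sum (map val Out)
    sIn  = sum (map val In)
    val₁ = assign In (λ _ → 0) val
    val₂ = assign Out g val₁

    sum-zeros : ∀ (ys : List (Fin nNodes)) → sum (map (λ _ → 0) ys) ≡ 0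
    sum-zeros []       = refl
    sum-zeros (_ ∷ ys) = sum-zeros ys

    val₁≡val-on-Out : map val₁ Out ≡ map val Out
    val₁≡val-on-Out = map-cong-local (All.tabulate λ v∈out → assign-∉ In _ val (outputs∉inputs v∈out))

    mass+a : ∑ val + a ≡ ∑ val₂ + ρ₀ + a
    mass+a = begin
      ∑ val + a                           ≡⟨ cong (_+ a) (+-identityʳ (∑ val)) ⟨
      ∑ val + 0 + a                       ≡⟨ cong (λ s → ∑ val + s + a) (sum-zeros In) ⟨
      ∑ val + sum (map (λ _ → 0) In) + a  ≡⟨ cong (_+ a) (∑-assign _ val (inputs-unique e)) ⟩
      ∑ val₁ + sIn + a                    ≡⟨ xy∙z≈xz∙y (∑ val₁) sIn a ⟩
      ∑ val₁ + a + sIn                    ≡⟨ cong (λ s → ∑ val₁ + s + sIn) sum-g≡a ⟨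
      ∑ val₁ + sum (map g Out) + sIn      ≡⟨ cong (_+ sIn) (∑-assign g val₁ (outputs-unique e)) ⟩
      ∑ val₂ + sum (map val₁ Out) + sIn   ≡⟨ cong (λ s → ∑ val₂ + sum s + sIn) val₁≡val-on-Out ⟩
      ∑ val₂ + sOut + sIn                 ≡⟨ +-assoc (∑ val₂) sOut sIn ⟩
      ∑ val₂ + (sOut + sIn)               ≡⟨ cong (∑ val₂ +_) split ⟩
      ∑ val₂ + (a + ρ₀)                   ≡⟨ xy∙z≈x∙zy (∑ val₂) ρ₀ a ⟨
      ∑ val₂ + ρ₀ + a                     ∎
      where open ≡-Reasoning

  record State (pending : List (Fin nEdges)) (x : ℕ) : Set where
    field
      val            : Fin nNodes → ℕ
      val∈node       : ∀ v → node v (val v)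
      ρ              : Fin nEdges → ℕ
      ρ∈rem          : ∀ {e} → e ∉ pending → ρ e ∈ rem e
      ρ-pending      : ∀ {e} → e ∈ pending → ρ e ≡ 0
      inputs-cleared : ∀ {e v} → e ∉ pending → v ∈ inputs e → val v ≡ 0
      feeders-done   : ∀ {e e′} → e ∉ pending → e′ feeds e → e′ ∉ pending
      total          : x ≡ ∑ val + ∑ ρ

  initial : ∀ {x} → S x → State (allFin nEdges) x
  initial {x} Sx with ∈ΣList⇒sum-map node (allFin⁺ nNodes) Sx
  ... | val , val∈node , sum≡x = record
    { val            = val
    ; val∈node       = λ v → val∈node (∈-allFin v)
    ; ρ              = λ _ → 0
    ; ρ∈rem          = λ e∉ → contradiction (∈-allFin _) e∉
    ; ρ-pending      = λ _ → refl
    ; inputs-cleared = λ e∉ _ → contradiction (∈-allFin _) e∉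
    ; feeders-done   = λ e∉ _ → contradiction (∈-allFin _) e∉
    ; total          = begin
        x                              ≡⟨ sum≡x ⟨
        sum (map val (allFin nNodes))  ≡⟨ ∑≡sum-allFin val ⟨
        ∑ val                          ≡⟨ +-identityʳ (∑ val) ⟨
        ∑ val + 0                      ≡⟨ cong (∑ val +_) (sum-replicate-zero nEdges) ⟨
        ∑ val + ∑ {nEdges} (λ _ → 0)   ∎
    }
    where open ≡-Reasoning

  step : ∀ {U x e} → State U x → e ∈ U → ¬ Any (_feeds e) U → State (U without e) x
  step {U} {x} {e} s e∈U minimal = record
    { val            = val′
    ; val∈node       = val′∈node
    ; ρ              = ρ′
    ; ρ∈rem          = ρ′∈rem
    ; ρ-pending      = ρ′-pending
    ; inputs-cleared = inputs-cleared′
    ; feeders-done   = feeders-done′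
    ; total          = total′
    }
    where
    open State s
    open EdgeReduction (reduce-along e val∈node)
    ρ′ = assign (e ∷ []) (λ _ → remainder) ρ

    was-done : ∀ {e′} → e′ ∉ U without e → e′ ≢ e → e′ ∉ U
    was-done e′∉U′ e′≢e e′∈U = e′∉U′ (∈-without⁺ e′∈U e′≢e)

    still-done : ∀ {e′} → e′ ∉ U → e′ ∉ U without e
    still-done e′∉U e′∈U′ = e′∉U (proj₁ (∈-without⁻ e′∈U′))

    ρ′-other : ∀ {e′} → e′ ≢ e → ρ′ e′ ≡ ρ e′
    ρ′-other e′≢e = assign-∉ (e ∷ []) _ ρ λ { (here e′≡e) → e′≢e e′≡e }

    ρ′∈rem : ∀ {e′} → e′ ∉ U without e → ρ′ e′ ∈ rem e′
    ρ′∈rem {e′} e′∉U′ = by-cases (e′ ≟ᶠ e)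
      where
      by-cases : Dec (e′ ≡ e) → ρ′ e′ ∈ rem e′
      by-cases (yes refl) = subst (_∈ rem e) (sym (assign-∈ (e ∷ []) _ ρ (here refl))) remainder∈rem
      by-cases (no  e′≢e) = subst (_∈ rem e′) (sym (ρ′-other e′≢e)) (ρ∈rem (was-done e′∉U′ e′≢e))

    ρ′-pending : ∀ {e′} → e′ ∈ U without e → ρ′ e′ ≡ 0
    ρ′-pending e′∈U′ with ∈-without⁻ e′∈U′
    ... | e′∈U , e′≢e = trans (ρ′-other e′≢e) (ρ-pending e′∈U)

    inputs-cleared′ : ∀ {e′ v} → e′ ∉ U without e → v ∈ inputs e′ → val′ v ≡ 0
    inputs-cleared′ {e′} {v} e′∉U′ v∈in′ = by-cases (e′ ≟ᶠ e) (v ∈? inputs e)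
      where
      by-cases : Dec (e′ ≡ e) → Dec (v ∈ inputs e) → val′ v ≡ 0
      by-cases (yes refl) _          = inputs-zero v∈in′
      by-cases (no  _)    (yes v∈in) = inputs-zero v∈in
      by-cases (no  e′≢e) (no  v∉in) = trans (untouched v∉out v∉in) (inputs-cleared e′∉U v∈in′)
        where
        e′∉U = was-done e′∉U′ e′≢e
        v∉out : v ∉ outputs e
        v∉out v∈out = feeders-done e′∉U (v , v∈out , v∈in′) e∈U

    feeders-done′ : ∀ {e₁ e₂} → e₁ ∉ U without e → e₂ feeds e₁ → e₂ ∉ U without e
    feeders-done′ {e₁} e₁∉U′ e₂-feeds with e₁ ≟ᶠ e
    ... | yes refl = still-done λ e₂∈U → minimal (lose e₂∈U e₂-feeds)
    ... | no  e₁≢e = still-done (feeders-done (was-done e₁∉U′ e₁≢e) e₂-feeds)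

    total′ : x ≡ ∑ val′ + ∑ ρ′
    total′ = begin
      x                           ≡⟨ total ⟩
      ∑ val + ∑ ρ                 ≡⟨ cong (_+ ∑ ρ) mass ⟩
      ∑ val′ + remainder + ∑ ρ    ≡⟨ xy∙z≈x∙zy (∑ val′) remainder (∑ ρ) ⟩
      ∑ val′ + (∑ ρ + remainder)  ≡⟨ cong (∑ val′ +_) ρ-mass ⟩
      ∑ val′ + ∑ ρ′               ∎
      where
      open ≡-Reasoning
      ρ-mass : ∑ ρ + remainder ≡ ∑ ρ′
      ρ-mass = begin
        ∑ ρ + remainder  ≡⟨ cong (∑ ρ +_) (assign-∈ (e ∷ []) _ ρ (here refl)) ⟨
        ∑ ρ + ρ′ e       ≡⟨ ∑-exchange e (λ _ e′≢e → sym (ρ′-other e′≢e)) ⟩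
        ∑ ρ′ + ρ e       ≡⟨ cong (∑ ρ′ +_) (ρ-pending e∈U) ⟩
        ∑ ρ′ + 0         ≡⟨ +-identityʳ (∑ ρ′) ⟩
        ∑ ρ′             ∎

  run : ∀ k {U x} → length U ≤ k → State U x → State [] x
  run _       {[]}     _           s = s
  run (suc k) {e₀ ∷ U} (s≤s |U|≤k) s with ∃-minimal _feeds?_ feeds-acyclic (here refl)
  ... | e , e∈U , minimal =
    run k (m<1+n⇒m≤n (<-≤-trans (length-without e∈U) (s≤s |U|≤k))) (step s e∈U minimal)

  final : ∀ {x} → State [] x → ∃₂ λ ρ k → (∀ e → ρ e ∈ rem e) × x ≡ r * k + ∑ ρ
  final s = ρ , k , (λ _ → ρ∈rem λ ())
          , trans total (cong (_+ ∑ ρ) (trans (∑-δ root nonroot-zero) val-root≡rk))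
    where
    open State s
    nonroot-zero : ∀ v → v ≢ root → val v ≡ 0
    nonroot-zero v v≢root with nonroot-input-once v v≢root
    ... | _ , v∈in , _ = inputs-cleared (λ ()) v∈in
    root-multiple = proj₁ (root-is-multiples (val root)) (val∈node root)
    k           = proj₁ root-multiple
    val-root≡rk = proj₂ root-multiple

  S⊆multiples+remainders : ∀ {x} → S x → ∃₂ λ ρ k → (∀ e → ρ e ∈ rem e) × x ≡ r * k + ∑ ρ
  S⊆multiples+remainders Sx = final (run _ ≤-refl (initial Sx))

lemma3p1 : (G : ReductionGraph) → IsNumericalSemigroup (ReductionGraph.S G) → BalanceAtMostOne G
lemma3p1 G ns = begin
  r                        ≤⟨ upTo⊆⇒≤length residues residue∈ ⟩
  length residues          ≡⟨ length-map (_% r) (choiceSums rem) ⟩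
  length (choiceSums rem)  ≡⟨ length-choiceSums rem ⟩
  weightProduct            ∎
  where
  open ReductionGraph G
  open IsNumericalSemigroup ns
  open ≤-Reasoning
  open import Data.List.Membership.DecPropositional _≟_ using (_∈?_)
  instance
    r≢0 : NonZero r
    r≢0 = >-nonZero r-pos

  residues = map (_% r) (choiceSums rem)

  S⇒residue : ∀ {x} → S x → x % r ∈ residues
  S⇒residue Sx with S⊆multiples+remainders G Sx
  ... | ρ , k , ρ∈rem , x≡rk+∑ρ =
    subst (_∈ residues) (sym x%r≡∑ρ%r) (∈-map⁺ (_% r) (∑∈choiceSums ρ∈rem))
    where
    x≡∑ρ+kr = trans x≡rk+∑ρ (trans (+-comm (r * k) (∑ ρ)) (cong (∑ ρ +_) (*-comm r k)))
    x%r≡∑ρ%r = trans (cong (_% r) x≡∑ρ+kr) ([m+kn]%n≡m%n (∑ ρ) k r)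

  residue∈ : ∀ {c} → c < r → c ∈ residues
  residue∈ {c} c<r = decidable-stable (c ∈? residues) (¬¬-map hit (cofinite⇒meets-residue cofinite r c))
    where
    hit : (∃ λ x → S x × x % r ≡ c % r) → c ∈ residues
    hit (x , Sx , x≡c) = subst (_∈ residues) (trans x≡c (m<n⇒m%n≡m c<r)) (S⇒residue Sx)
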